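{- For every $n\in\mathbb{N}$ and every integer $z_0\ge2$, the integers $\tilde P_n(z_0)$ and $\tilde Q_n(z_0)$ satisfy $$\left|f(z_0)-\frac{\tilde P_n(z_0)}{\tilde Q_n(z_0)}\right|\le C\cdot z_0^{ -36\cdot 2^n},\qquad \tilde Q_n(z_0)\le 2\cdot z_0^{18\cdot 2^n},$$ where the constant $C=C(z_0)>0$ does not depend on $n$.
   Context: Let $(t_n)_{n\ge0}$ be the Thue–Morse sequence ($t_0=0$, $t_{2n}=t_n$, $t_{2n+1}=1-t_n$) and $f(z)=\sum_{i\ge0}(-1)^{t_i}z^{ -i-1}=z^{ -1}\prod_{k=0}^\infty(1-z^{ -2^k})$, which converges for real $|z|>1$. Let $\hat P_9(z)=z^8-3z^6+2z^4+3z^2-4$ and $\hat Q_9(z)=(z+1)(z^8-z^6+z^2+2)$. For $n\in\mathbb{N}$ define $\tilde P_n(z)=\prod_{k=0}^{n}(z^{2^k}-1)\cdot\hat P_9(z^{2^{n+1}})$ and $\tilde Q_n(z)=\hat Q_9(z^{2^{n+1}})$. -}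

module Defs where

open import Data.Bool using (Bool; true; false; not; if_then_else_)
open import Data.Nat as ℕ using (ℕ; zero; suc; ⌊_/2⌋)
open import Data.Nat.DivMod using (_%_)
open import Data.Integer as ℤ using (ℤ; +_; +[1+_]; -[1+_])
open import Data.Rational as ℚ using (ℚ; _/_; 0ℚ)
open import Data.Product using (∃-syntax; _×_)

-- Thue–Morse sequence: t 0 = 0, t (2n) = t n, t (2n+1) = 1 - t n.
-- (true = 1, false = 0.)  Computed by halving recursion with fuel;
-- fuel n suffices for argument n since halving reaches 0 in ≤ n steps.

tmFuel : ℕ → ℕ → Bool
tmFuel zero    _ = false
tmFuel (suc k) n with n % 2
... | zero  = tmFuel k ⌊ n /2⌋
... | suc _ = not (tmFuel k ⌊ n /2⌋)

tm : ℕ → Bool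
tm n = tmFuel n n

sgn : ℕ → ℤ
sgn i = if tm i then ℤ.- (+ 1) else + 1

-- Integer power and the rational p/q for integers p, q (q ≠ 0);
-- by convention frac p 0 = 0 (only ever used with q ≠ 0).

_^ℤ_ : ℤ → ℕ → ℤ
x ^ℤ zero    = + 1
x ^ℤ suc k   = x ℤ.* (x ^ℤ k)

frac : ℤ → ℤ → ℚ
frac p (+ zero)    = 0ℚ
frac p +[1+ d ]    = p / suc d
frac p -[1+ d ]    = (ℤ.- p) / suc d

-- Partial sums of f(z) = Σ_{i≥0} (-1)^{t_i} z^{-i-1}:
-- S z N = Σ_{i<N} (-1)^{t_i} z^{-i-1}.

S : ℤ → ℕ → ℚ
S z zero    = 0ℚ
S z (suc N) = S z N ℚ.+ frac (sgn N) (z ^ℤ suc N)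

-- |f(z) - r| ≤ ε, where f(z) = lim_{N→∞} S z N (a real number):
-- for every δ > 0, eventually |S z N - r| ≤ ε + δ.
∣f_-_∣≤_ : ℤ → ℚ → ℚ → Set
∣f z - r ∣≤ ε =
  ∀ (δ : ℚ) → 0ℚ ℚ.< δ →
    ∃[ N₀ ] (∀ N → N₀ ℕ.≤ N → ℚ.∣ S z N ℚ.- r ∣ ℚ.≤ ε ℚ.+ δ)

Phat9 : ℤ → ℤ
Phat9 z = z ^ℤ 8 ℤ.- (+ 3) ℤ.* z ^ℤ 6 ℤ.+ (+ 2) ℤ.* z ^ℤ 4
          ℤ.+ (+ 3) ℤ.* z ^ℤ 2 ℤ.- (+ 4)

Qhat9 : ℤ → ℤ
Qhat9 z = (z ℤ.+ + 1) ℤ.* (z ^ℤ 8 ℤ.- z ^ℤ 6 ℤ.+ z ^ℤ 2 ℤ.+ + 2)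

prodFactors : ℕ → ℤ → ℤ
prodFactors zero    z = z ℤ.- + 1
prodFactors (suc n) z = prodFactors n z ℤ.* (z ^ℤ (2 ℕ.^ suc n) ℤ.- + 1)

Ptilde : ℕ → ℤ → ℤ
Ptilde n z = prodFactors n z ℤ.* Phat9 (z ^ℤ (2 ℕ.^ suc n))

Qtilde : ℕ → ℤ → ℤ
Qtilde n z = Qhat9 (z ^ℤ (2 ℕ.^ suc n))

{-# OPTIONS --safe #-}

-- Write the partial sums as S_N = h_N / z^N with h_N = Σ_{i<N} (-1)^{t_i} z^{N-1-i}.
-- Since t (2^k q + r) = t q xor t r for r < 2^k, h is multiplicative over blocks of
-- length M = 2^(n+1): h_{KM} = Π · h'_K, where Π = ∏_{k≤n} (z^(2^k) - 1) is the first
-- block and h'_K is the same sum for W = z^M.  (Phat9, Qhat9) is a Padé approximant of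
-- f: the first nine coefficients of Qhat9 · f - Phat9 vanish.  Hence
-- Qhat9(W) h'_K - Phat9(W) W^K is a tail of size O(W^(K-9)) minus a polynomial part of
-- size O(W^8), which for N ≥ 18 M gives |S_N - Ptilde/Qtilde| ≤ 41 W^(-18); and
-- W^9 ≤ Qhat9(W) ≤ 2 W^9, since Qhat9(2 + u) - (2 + u)^9 and 2 (2 + u)^9 - Qhat9(2 + u)
-- are polynomials in u with nonnegative coefficients.
module Submission where

open import Defs
open import Data.Bool using (Bool; true; false; not; if_then_else_; _xor_)
open import Data.Bool.Properties using (xor-identityʳ; xor-assoc; xor-comm)
open import Data.Nat as ℕ using (ℕ; zero; suc; ⌊_/2⌋; _≤_; _<_; z≤n; s≤s)
import Data.Nat.Properties as ℕP
open import Data.Nat.DivMod using (_%_; _/_; m%n<n; [m+kn]%n≡m%n; m≡m%n+[m/n]*n; m*n/n≡m; /-monoˡ-≤)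
open import Data.Integer as ℤ using (ℤ; +_; ∣_∣)
import Data.Integer.Properties as ℤP
open import Data.List using (List; []; _∷_; map; length)
open import Data.Product using (∃-syntax; _×_; _,_; proj₁; proj₂)
open import Data.Rational as ℚ using (ℚ; 0ℚ; toℚᵘ)
import Data.Rational.Properties as ℚP
open import Data.Rational.Unnormalised as ℚᵘ using (mkℚᵘ; *≤*; *≡*) renaming (_/_ to _/ᵘ_)
import Data.Rational.Unnormalised.Properties as ℚᵘP
open import Relation.Binary.PropositionalEquality
import Data.Nat.Tactic.RingSolver as ℕ-Solver
import Data.Integer.Tactic.RingSolver as ℤ-Solver
open import Tactic.RingSolver.NonReflective ℤ-Solver.ring using (Expr; Κ; _⊕_; _⊗_; ⊝_; solve; _⊜_)

-- Thue–Morse block structure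

n≤1+k⇒⌊n/2⌋≤k : ∀ {n k} → n ≤ suc k → ⌊ n /2⌋ ≤ k
n≤1+k⇒⌊n/2⌋≤k {zero}  _ = z≤n
n≤1+k⇒⌊n/2⌋≤k {suc n} h = ℕP.≤-pred (ℕP.≤-trans (ℕP.⌊n/2⌋<n n) h)

n<2m⇒⌊n/2⌋<m : ∀ {n m} → n < 2 ℕ.* m → ⌊ n /2⌋ < m
n<2m⇒⌊n/2⌋<m {zero}        {suc m} _ = s≤s z≤n
n<2m⇒⌊n/2⌋<m {suc zero}    {suc m} _ = s≤s z≤n
n<2m⇒⌊n/2⌋<m {suc (suc n)} {suc m} (s≤s h) =
  s≤s (n<2m⇒⌊n/2⌋<m (ℕP.≤-pred (subst (suc (suc n) ≤_) (ℕP.+-suc m (m ℕ.+ 0)) h)))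

⌊2m+n/2⌋≡m+⌊n/2⌋ : ∀ m n → ⌊ 2 ℕ.* m ℕ.+ n /2⌋ ≡ m ℕ.+ ⌊ n /2⌋
⌊2m+n/2⌋≡m+⌊n/2⌋ zero    n = refl
⌊2m+n/2⌋≡m+⌊n/2⌋ (suc m) n =
  trans (cong ⌊_/2⌋ (2[1+m]+n m n)) (cong suc (⌊2m+n/2⌋≡m+⌊n/2⌋ m n))
  where
  2[1+m]+n : ∀ m n → 2 ℕ.* suc m ℕ.+ n ≡ suc (suc (2 ℕ.* m ℕ.+ n))
  2[1+m]+n = ℕ-Solver.solve-∀

[2m+n]%2≡n%2 : ∀ m n → (2 ℕ.* m ℕ.+ n) % 2 ≡ n % 2
[2m+n]%2≡n%2 m n =
  trans (cong (_% 2) (trans (ℕP.+-comm (2 ℕ.* m) n) (cong (n ℕ.+_) (ℕP.*-comm 2 m))))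
        ([m+kn]%n≡m%n n m 2)

tmFuel-zero : ∀ k → tmFuel k 0 ≡ false
tmFuel-zero zero    = refl
tmFuel-zero (suc k) = tmFuel-zero k

tmFuel-stable : ∀ {k k′ n} → n ≤ k → n ≤ k′ → tmFuel k n ≡ tmFuel k′ n
tmFuel-stable {zero}  {k′}     z≤n _   = sym (tmFuel-zero k′)
tmFuel-stable {suc k} {zero}   _   z≤n = tmFuel-zero (suc k)
tmFuel-stable {suc k} {suc k′} {n} h h′ with n % 2
... | zero  = tmFuel-stable (n≤1+k⇒⌊n/2⌋≤k h) (n≤1+k⇒⌊n/2⌋≤k h′)
... | suc _ = cong not (tmFuel-stable (n≤1+k⇒⌊n/2⌋≤k h) (n≤1+k⇒⌊n/2⌋≤k h′))

tmFuel-suc : ∀ k n → tmFuel (suc k) n ≡ tm (n % 2) xor tmFuel k ⌊ n /2⌋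
tmFuel-suc k n with n % 2 | m%n<n n 2
... | 0           | _ = refl
... | 1           | _ = refl
... | suc (suc _) | s≤s (s≤s ())

tm-halve : ∀ n → tm n ≡ tm (n % 2) xor tm ⌊ n /2⌋
tm-halve n = begin
  tmFuel n n                               ≡⟨ tmFuel-stable ℕP.≤-refl (ℕP.n≤1+n n) ⟩
  tmFuel (suc n) n                         ≡⟨ tmFuel-suc n n ⟩
  tm (n % 2) xor tmFuel n ⌊ n /2⌋          ≡⟨ cong (tm (n % 2) xor_) (tmFuel-stable (ℕP.⌊n/2⌋≤n n) ℕP.≤-refl) ⟩
  tm (n % 2) xor tm ⌊ n /2⌋                ∎
  where open ≡-Reasoning

tm-2^k*q+r : ∀ k q r → r < 2 ℕ.^ k → tm (2 ℕ.^ k ℕ.* q ℕ.+ r) ≡ tm q xor tm r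
tm-2^k*q+r zero q zero _ =
  trans (cong tm (trans (ℕP.+-identityʳ _) (ℕP.*-identityˡ q))) (sym (xor-identityʳ (tm q)))
tm-2^k*q+r zero q (suc r) (s≤s ())
tm-2^k*q+r (suc k) q r r<2^[1+k] = begin
  tm (2 ℕ.^ suc k ℕ.* q ℕ.+ r)                 ≡⟨ cong (λ m → tm (m ℕ.+ r)) (ℕP.*-assoc 2 (2 ℕ.^ k) q) ⟩
  tm (2 ℕ.* m ℕ.+ r)                           ≡⟨ tm-halve (2 ℕ.* m ℕ.+ r) ⟩
  tm ((2 ℕ.* m ℕ.+ r) % 2) xor tm ⌊ 2 ℕ.* m ℕ.+ r /2⌋
    ≡⟨ cong₂ (λ a b → tm a xor tm b) ([2m+n]%2≡n%2 m r) (⌊2m+n/2⌋≡m+⌊n/2⌋ m r) ⟩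
  tm (r % 2) xor tm (m ℕ.+ ⌊ r /2⌋)            ≡⟨ cong (tm (r % 2) xor_) (tm-2^k*q+r k q ⌊ r /2⌋ (n<2m⇒⌊n/2⌋<m r<2^[1+k])) ⟩
  tm (r % 2) xor (tm q xor tm ⌊ r /2⌋)         ≡⟨ sym (xor-assoc (tm (r % 2)) (tm q) _) ⟩
  (tm (r % 2) xor tm q) xor tm ⌊ r /2⌋         ≡⟨ cong (_xor tm ⌊ r /2⌋) (xor-comm (tm (r % 2)) (tm q)) ⟩
  (tm q xor tm (r % 2)) xor tm ⌊ r /2⌋         ≡⟨ xor-assoc (tm q) (tm (r % 2)) _ ⟩
  tm q xor (tm (r % 2) xor tm ⌊ r /2⌋)         ≡⟨ cong (tm q xor_) (sym (tm-halve r)) ⟩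
  tm q xor tm r                                ∎
  where
  open ≡-Reasoning
  m : ℕ
  m = 2 ℕ.^ k ℕ.* q

sgn-2^k*q+r : ∀ k q r → r < 2 ℕ.^ k → sgn (2 ℕ.^ k ℕ.* q ℕ.+ r) ≡ sgn q ℤ.* sgn r
sgn-2^k*q+r k q r r<2^k = trans (cong ±1 (tm-2^k*q+r k q r r<2^k)) (±1-xor (tm q) (tm r))
  where
  ±1 : Bool → ℤ
  ±1 b = if b then ℤ.- (+ 1) else + 1
  ±1-xor : ∀ b c → ±1 (b xor c) ≡ ±1 b ℤ.* ±1 c
  ±1-xor true  true  = refl
  ±1-xor true  false = refl
  ±1-xor false true  = refl
  ±1-xor false false = refl

-- Horner sums

^ℤ-+ : ∀ x a b → x ^ℤ (a ℕ.+ b) ≡ x ^ℤ a ℤ.* x ^ℤ b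
^ℤ-+ x zero    b = sym (ℤP.*-identityˡ (x ^ℤ b))
^ℤ-+ x (suc a) b = trans (cong (x ℤ.*_) (^ℤ-+ x a b)) (sym (ℤP.*-assoc x (x ^ℤ a) (x ^ℤ b)))

^ℤ-* : ∀ x a b → x ^ℤ (a ℕ.* b) ≡ (x ^ℤ b) ^ℤ a
^ℤ-* x zero    b = refl
^ℤ-* x (suc a) b = trans (^ℤ-+ x b (a ℕ.* b)) (cong (x ^ℤ b ℤ.*_) (^ℤ-* x a b))

+-^ℤ : ∀ z k → (+ z) ^ℤ k ≡ + (z ℕ.^ k)
+-^ℤ z zero    = refl
+-^ℤ z (suc k) = trans (cong (+ z ℤ.*_) (+-^ℤ z k)) (sym (ℤP.pos-* z (z ℕ.^ k)))

horner : (ℕ → ℤ) → ℤ → ℕ → ℤ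
horner σ x zero    = + 0
horner σ x (suc N) = x ℤ.* horner σ x N ℤ.+ σ N

horner-cong : ∀ {σ τ} x n → (∀ i → i < n → σ i ≡ τ i) → horner σ x n ≡ horner τ x n
horner-cong x zero    σ≗τ = refl
horner-cong x (suc n) σ≗τ =
  cong₂ (λ h s → x ℤ.* h ℤ.+ s) (horner-cong x n (λ i i<n → σ≗τ i (ℕP.m≤n⇒m≤1+n i<n))) (σ≗τ n ℕP.≤-refl)

horner-*ˡ : ∀ c σ x n → horner (λ i → c ℤ.* σ i) x n ≡ c ℤ.* horner σ x n
horner-*ˡ c σ x zero    = sym (ℤP.*-zeroʳ c)
horner-*ˡ c σ x (suc n) =
  trans (cong (λ h → x ℤ.* h ℤ.+ c ℤ.* σ n) (horner-*ˡ c σ x n)) (shuffle x c (horner σ x n) (σ n))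
  where
  shuffle : ∀ x c h s → x ℤ.* (c ℤ.* h) ℤ.+ c ℤ.* s ≡ c ℤ.* (x ℤ.* h ℤ.+ s)
  shuffle = ℤ-Solver.solve-∀

horner-+ : ∀ σ x a b → horner σ x (a ℕ.+ b) ≡ x ^ℤ b ℤ.* horner σ x a ℤ.+ horner (λ i → σ (a ℕ.+ i)) x b
horner-+ σ x a zero = begin
  horner σ x (a ℕ.+ 0)       ≡⟨ cong (horner σ x) (ℕP.+-identityʳ a) ⟩
  horner σ x a               ≡⟨ unit (horner σ x a) ⟩
  + 1 ℤ.* horner σ x a ℤ.+ + 0 ∎
  where
  open ≡-Reasoning
  unit : ∀ h → h ≡ + 1 ℤ.* h ℤ.+ + 0
  unit = ℤ-Solver.solve-∀
horner-+ σ x a (suc b) = begin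
  horner σ x (a ℕ.+ suc b)
    ≡⟨ cong (horner σ x) (ℕP.+-suc a b) ⟩
  x ℤ.* horner σ x (a ℕ.+ b) ℤ.+ σ (a ℕ.+ b)
    ≡⟨ cong (λ h → x ℤ.* h ℤ.+ σ (a ℕ.+ b)) (horner-+ σ x a b) ⟩
  x ℤ.* (x ^ℤ b ℤ.* horner σ x a ℤ.+ horner (λ i → σ (a ℕ.+ i)) x b) ℤ.+ σ (a ℕ.+ b)
    ≡⟨ shuffle x (x ^ℤ b) (horner σ x a) _ _ ⟩
  x ^ℤ suc b ℤ.* horner σ x a ℤ.+ horner (λ i → σ (a ℕ.+ i)) x (suc b) ∎
  where
  open ≡-Reasoning
  shuffle : ∀ x p h t s → x ℤ.* (p ℤ.* h ℤ.+ t) ℤ.+ s ≡ x ℤ.* p ℤ.* h ℤ.+ (x ℤ.* t ℤ.+ s)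
  shuffle = ℤ-Solver.solve-∀

horner-sgn-*2^k : ∀ k x K → horner sgn x (K ℕ.* 2 ℕ.^ k) ≡ horner sgn x (2 ℕ.^ k) ℤ.* horner sgn (x ^ℤ (2 ℕ.^ k)) K
horner-sgn-*2^k k x zero    = sym (ℤP.*-zeroʳ (horner sgn x (2 ℕ.^ k)))
horner-sgn-*2^k k x (suc K) = begin
  horner sgn x (M ℕ.+ K ℕ.* M)
    ≡⟨ cong (horner sgn x) (ℕP.+-comm M (K ℕ.* M)) ⟩
  horner sgn x (K ℕ.* M ℕ.+ M)
    ≡⟨ horner-+ sgn x (K ℕ.* M) M ⟩
  x ^ℤ M ℤ.* horner sgn x (K ℕ.* M) ℤ.+ horner (λ i → sgn (K ℕ.* M ℕ.+ i)) x M
    ≡⟨ cong₂ (λ h t → x ^ℤ M ℤ.* h ℤ.+ t) (horner-sgn-*2^k k x K) block ⟩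
  x ^ℤ M ℤ.* (Π ℤ.* horner sgn (x ^ℤ M) K) ℤ.+ sgn K ℤ.* Π
    ≡⟨ shuffle (x ^ℤ M) Π (horner sgn (x ^ℤ M) K) (sgn K) ⟩
  Π ℤ.* horner sgn (x ^ℤ M) (suc K) ∎
  where
  open ≡-Reasoning
  M : ℕ
  M = 2 ℕ.^ k
  Π : ℤ
  Π = horner sgn x M
  block : horner (λ i → sgn (K ℕ.* M ℕ.+ i)) x M ≡ sgn K ℤ.* Π
  block = trans (horner-cong x M (λ i i<M → trans (cong (λ m → sgn (m ℕ.+ i)) (ℕP.*-comm K M)) (sgn-2^k*q+r k K i i<M)))
                (horner-*ˡ (sgn K) sgn x M)
  shuffle : ∀ w p h s → w ℤ.* (p ℤ.* h) ℤ.+ s ℤ.* p ≡ p ℤ.* (w ℤ.* h ℤ.+ s)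
  shuffle = ℤ-Solver.solve-∀

horner-sgn-2^[1+n] : ∀ n x → horner sgn x (2 ℕ.^ suc n) ≡ prodFactors n x
horner-sgn-2^[1+n] zero    x = horner-sgn-2 x
  where
  horner-sgn-2 : ∀ x → x ℤ.* (x ℤ.* + 0 ℤ.+ + 1) ℤ.+ ℤ.- + 1 ≡ x ℤ.- + 1
  horner-sgn-2 = ℤ-Solver.solve-∀
horner-sgn-2^[1+n] (suc n) x =
  trans (horner-sgn-*2^k (suc n) x 2)
        (cong₂ ℤ._*_ (horner-sgn-2^[1+n] n x) (horner-sgn-2^[1+n] zero (x ^ℤ (2 ℕ.^ suc n))))

-- Weighted sums and the Padé remainder

weightedSum : List ℤ → (ℕ → ℤ) → ℤ
weightedSum []       F = + 0
weightedSum (q ∷ qs) F = q ℤ.* F 0 ℤ.+ weightedSum qs (λ j → F (suc j))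

weightedSum-cong : ∀ qs {F G} → (∀ j → F j ≡ G j) → weightedSum qs F ≡ weightedSum qs G
weightedSum-cong []       F≗G = refl
weightedSum-cong (q ∷ qs) F≗G = cong₂ (λ a b → q ℤ.* a ℤ.+ b) (F≗G 0) (weightedSum-cong qs (λ j → F≗G (suc j)))

weightedSum-+ : ∀ qs F G → weightedSum qs (λ j → F j ℤ.+ G j) ≡ weightedSum qs F ℤ.+ weightedSum qs G
weightedSum-+ []       F G = refl
weightedSum-+ (q ∷ qs) F G =
  trans (cong (λ s → q ℤ.* (F 0 ℤ.+ G 0) ℤ.+ s) (weightedSum-+ qs (λ j → F (suc j)) (λ j → G (suc j))))
        (shuffle q (F 0) (G 0) _ _)
  where
  shuffle : ∀ q f g s t → q ℤ.* (f ℤ.+ g) ℤ.+ (s ℤ.+ t) ≡ (q ℤ.* f ℤ.+ s) ℤ.+ (q ℤ.* g ℤ.+ t)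
  shuffle = ℤ-Solver.solve-∀

weightedSum-*ˡ : ∀ qs c F → weightedSum qs (λ j → c ℤ.* F j) ≡ c ℤ.* weightedSum qs F
weightedSum-*ˡ []       c F = sym (ℤP.*-zeroʳ c)
weightedSum-*ˡ (q ∷ qs) c F =
  trans (cong (λ s → q ℤ.* (c ℤ.* F 0) ℤ.+ s) (weightedSum-*ˡ qs c (λ j → F (suc j)))) (shuffle q c (F 0) _)
  where
  shuffle : ∀ q c f s → q ℤ.* (c ℤ.* f) ℤ.+ c ℤ.* s ≡ c ℤ.* (q ℤ.* f ℤ.+ s)
  shuffle = ℤ-Solver.solve-∀

weightedSum-*ʳ : ∀ qs c F → weightedSum qs (λ j → F j ℤ.* c) ≡ weightedSum qs F ℤ.* c
weightedSum-*ʳ qs c F =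
  trans (weightedSum-cong qs (λ j → ℤP.*-comm (F j) c))
        (trans (weightedSum-*ˡ qs c F) (ℤP.*-comm c (weightedSum qs F)))

weightedSum-horner : ∀ qs (τ : ℕ → ℕ → ℤ) x K →
  weightedSum qs (λ j → horner (τ j) x K) ≡ horner (λ m → weightedSum qs (λ j → τ j m)) x K
weightedSum-horner qs τ x zero    = weightedSum-zero qs
  where
  weightedSum-zero : ∀ qs → weightedSum qs (λ _ → + 0) ≡ + 0
  weightedSum-zero []       = refl
  weightedSum-zero (q ∷ qs) = trans (cong (λ s → q ℤ.* + 0 ℤ.+ s) (weightedSum-zero qs)) (trans (ℤP.+-identityʳ _) (ℤP.*-zeroʳ q))
weightedSum-horner qs τ x (suc K) = begin
  weightedSum qs (λ j → x ℤ.* horner (τ j) x K ℤ.+ τ j K)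
    ≡⟨ weightedSum-+ qs (λ j → x ℤ.* horner (τ j) x K) (λ j → τ j K) ⟩
  weightedSum qs (λ j → x ℤ.* horner (τ j) x K) ℤ.+ weightedSum qs (λ j → τ j K)
    ≡⟨ cong (ℤ._+ weightedSum qs (λ j → τ j K)) (weightedSum-*ˡ qs x (λ j → horner (τ j) x K)) ⟩
  x ℤ.* weightedSum qs (λ j → horner (τ j) x K) ℤ.+ weightedSum qs (λ j → τ j K)
    ≡⟨ cong (λ h → x ℤ.* h ℤ.+ weightedSum qs (λ j → τ j K)) (weightedSum-horner qs τ x K) ⟩
  horner (λ m → weightedSum qs (λ j → τ j m)) x (suc K) ∎
  where open ≡-Reasoning

polynomial : List ℤ → ℤ → ℤ
polynomial qs x = weightedSum qs (x ^ℤ_)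

-- For f_σ(x) = Σ_i σ i x^(-i-1) and Q = polynomial qs, the Laurent series Q f_σ is
-- polynomialPart qs σ x + Σ_m tailCoefficient qs σ m x^(-m-1).
polynomialPart : List ℤ → (ℕ → ℤ) → ℤ → ℤ
polynomialPart qs σ x = weightedSum qs (horner σ x)

tailCoefficient : List ℤ → (ℕ → ℤ) → ℕ → ℤ
tailCoefficient qs σ m = weightedSum qs (λ j → σ (j ℕ.+ m))

polynomial*horner : ∀ qs σ x K →
  polynomial qs x ℤ.* horner σ x K ℤ.+ polynomialPart qs (λ i → σ (K ℕ.+ i)) x
    ≡ x ^ℤ K ℤ.* polynomialPart qs σ x ℤ.+ horner (tailCoefficient qs σ) x K
polynomial*horner qs σ x K = begin
  weightedSum qs (x ^ℤ_) ℤ.* T ℤ.+ weightedSum qs (horner σₖ x)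
    ≡⟨ cong (ℤ._+ weightedSum qs (horner σₖ x)) (sym (weightedSum-*ʳ qs T (x ^ℤ_))) ⟩
  weightedSum qs (λ j → x ^ℤ j ℤ.* T) ℤ.+ weightedSum qs (horner σₖ x)
    ≡⟨ sym (weightedSum-+ qs (λ j → x ^ℤ j ℤ.* T) (horner σₖ x)) ⟩
  weightedSum qs (λ j → x ^ℤ j ℤ.* T ℤ.+ horner σₖ x j)
    ≡⟨ weightedSum-cong qs splitTwice ⟩
  weightedSum qs (λ j → x ^ℤ K ℤ.* horner σ x j ℤ.+ horner (λ m → σ (j ℕ.+ m)) x K)
    ≡⟨ weightedSum-+ qs (λ j → x ^ℤ K ℤ.* horner σ x j) (λ j → horner (λ m → σ (j ℕ.+ m)) x K) ⟩
  weightedSum qs (λ j → x ^ℤ K ℤ.* horner σ x j) ℤ.+ weightedSum qs (λ j → horner (λ m → σ (j ℕ.+ m)) x K)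
    ≡⟨ cong₂ ℤ._+_ (weightedSum-*ˡ qs (x ^ℤ K) (horner σ x)) (weightedSum-horner qs (λ j m → σ (j ℕ.+ m)) x K) ⟩
  x ^ℤ K ℤ.* weightedSum qs (horner σ x) ℤ.+ horner (tailCoefficient qs σ) x K ∎
  where
  open ≡-Reasoning
  T : ℤ
  T = horner σ x K
  σₖ : ℕ → ℤ
  σₖ i = σ (K ℕ.+ i)
  splitTwice : ∀ j → x ^ℤ j ℤ.* T ℤ.+ horner σₖ x j ≡ x ^ℤ K ℤ.* horner σ x j ℤ.+ horner (λ m → σ (j ℕ.+ m)) x K
  splitTwice j = trans (sym (horner-+ σ x K j)) (trans (cong (horner σ x) (ℕP.+-comm K j)) (horner-+ σ x j K))

Qhat9-coefficients : List ℤ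
Qhat9-coefficients = + 2 ∷ + 2 ∷ + 1 ∷ + 1 ∷ + 0 ∷ + 0 ∷ ℤ.- + 1 ∷ ℤ.- + 1 ∷ + 1 ∷ + 1 ∷ []

-- Coefficients in u of Qhat9 (2 + u) - (2 + u)^9 and of 2 (2 + u)^9 - Qhat9 (2 + u).
Qhat9-lowerSlack Qhat9-upperSlack : List ℕ
Qhat9-lowerSlack = 82 ∷ 402 ∷ 887 ∷ 1073 ∷ 780 ∷ 352 ∷ 97 ∷ 15 ∷ 1 ∷ []
Qhat9-upperSlack = 430 ∷ 1902 ∷ 3721 ∷ 4303 ∷ 3252 ∷ 1664 ∷ 575 ∷ 129 ∷ 17 ∷ 1 ∷ []

-- Copies of the definitions as ring-solver syntax; on concrete lists their
-- semantics unfold definitionally to the originals.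
private module Syntax {n : ℕ} where

  _^ᴱ_ : Expr ℤ n → ℕ → Expr ℤ n
  x ^ᴱ zero  = Κ (+ 1)
  x ^ᴱ suc k = x ⊗ (x ^ᴱ k)

  hornerᴱ : (ℕ → ℤ) → Expr ℤ n → ℕ → Expr ℤ n
  hornerᴱ σ x zero    = Κ (+ 0)
  hornerᴱ σ x (suc N) = x ⊗ hornerᴱ σ x N ⊕ Κ (σ N)

  weightedSumᴱ : List ℤ → (ℕ → Expr ℤ n) → Expr ℤ n
  weightedSumᴱ []       F = Κ (+ 0)
  weightedSumᴱ (q ∷ qs) F = Κ q ⊗ F 0 ⊕ weightedSumᴱ qs (λ j → F (suc j))

  Phat9ᴱ Qhat9ᴱ : Expr ℤ n → Expr ℤ n
  Phat9ᴱ z = z ^ᴱ 8 ⊕ ⊝ (Κ (+ 3) ⊗ z ^ᴱ 6) ⊕ Κ (+ 2) ⊗ z ^ᴱ 4 ⊕ Κ (+ 3) ⊗ z ^ᴱ 2 ⊕ ⊝ Κ (+ 4)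
  Qhat9ᴱ z = (z ⊕ Κ (+ 1)) ⊗ (z ^ᴱ 8 ⊕ ⊝ (z ^ᴱ 6) ⊕ z ^ᴱ 2 ⊕ Κ (+ 2))

open Syntax

Qhat9≡polynomial : ∀ W → Qhat9 W ≡ polynomial Qhat9-coefficients W
Qhat9≡polynomial = solve 1 (λ W → Qhat9ᴱ W ⊜ weightedSumᴱ Qhat9-coefficients (W ^ᴱ_)) refl

Phat9≡polynomialPart : ∀ W → Phat9 W ≡ polynomialPart Qhat9-coefficients sgn W
Phat9≡polynomialPart = solve 1 (λ W → Phat9ᴱ W ⊜ weightedSumᴱ Qhat9-coefficients (hornerᴱ sgn W)) refl

Qhat9-shift-lower : ∀ U → Qhat9 (+ 2 ℤ.+ U) ≡ (+ 2 ℤ.+ U) ^ℤ 9 ℤ.+ polynomial (map +_ Qhat9-lowerSlack) U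
Qhat9-shift-lower = solve 1 (λ U → Qhat9ᴱ (Κ (+ 2) ⊕ U) ⊜ ((Κ (+ 2) ⊕ U) ^ᴱ 9 ⊕ weightedSumᴱ (map +_ Qhat9-lowerSlack) (U ^ᴱ_))) refl

Qhat9-shift-upper : ∀ U → Qhat9 (+ 2 ℤ.+ U) ℤ.+ polynomial (map +_ Qhat9-upperSlack) U ≡ + 2 ℤ.* (+ 2 ℤ.+ U) ^ℤ 9
Qhat9-shift-upper = solve 1 (λ U → (Qhat9ᴱ (Κ (+ 2) ⊕ U) ⊕ weightedSumᴱ (map +_ Qhat9-upperSlack) (U ^ᴱ_)) ⊜ Κ (+ 2) ⊗ (Κ (+ 2) ⊕ U) ^ᴱ 9) refl

-- The Padé property of (Phat9, Qhat9): the first nine tail coefficients vanish.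
horner-tailCoefficient-sgn-9 : ∀ W → horner (tailCoefficient Qhat9-coefficients sgn) W 9 ≡ + 0
horner-tailCoefficient-sgn-9 = solve 1 (λ W → hornerᴱ (tailCoefficient Qhat9-coefficients sgn) W 9 ⊜ Κ (+ 0)) refl

-- Size estimates

∣sgn∣≤1 : ∀ i → ∣ sgn i ∣ ≤ 1
∣sgn∣≤1 i with tm i
... | true  = ℕP.≤-refl
... | false = ℕP.≤-refl

-- The geometric sum Σ_{i<n} (1 + v)^i = ((1 + v)^n - 1) / v, stated without division.
∣horner∣≤ : ∀ σ x n B v → ∣ x ∣ ≡ suc v → (∀ i → i < n → ∣ σ i ∣ ≤ B) →
  v ℕ.* ∣ horner σ x n ∣ ℕ.+ B ≤ B ℕ.* suc v ℕ.^ n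
∣horner∣≤ σ x zero    B v ∣x∣≡1+v σ≤B =
  ℕP.≤-reflexive (trans (cong (ℕ._+ B) (ℕP.*-zeroʳ v)) (sym (ℕP.*-identityʳ B)))
∣horner∣≤ σ x (suc n) B v ∣x∣≡1+v σ≤B = begin
  v ℕ.* ∣ x ℤ.* h ℤ.+ σ n ∣ ℕ.+ B
    ≤⟨ ℕP.+-monoˡ-≤ B (ℕP.*-monoʳ-≤ v (ℕP.≤-trans (ℤP.∣i+j∣≤∣i∣+∣j∣ (x ℤ.* h) (σ n))
         (ℕP.+-mono-≤ (ℕP.≤-reflexive (trans (ℤP.abs-* x h) (cong (ℕ._* ∣ h ∣) ∣x∣≡1+v))) (σ≤B n ℕP.≤-refl)))) ⟩
  v ℕ.* (suc v ℕ.* ∣ h ∣ ℕ.+ B) ℕ.+ B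
    ≡⟨ shuffle v ∣ h ∣ B ⟩
  suc v ℕ.* (v ℕ.* ∣ h ∣ ℕ.+ B)
    ≤⟨ ℕP.*-monoʳ-≤ (suc v) (∣horner∣≤ σ x n B v ∣x∣≡1+v (λ i i<n → σ≤B i (ℕP.m≤n⇒m≤1+n i<n))) ⟩
  suc v ℕ.* (B ℕ.* suc v ℕ.^ n)
    ≡⟨ ℕP.*-comm (suc v) (B ℕ.* suc v ℕ.^ n) ⟩
  B ℕ.* suc v ℕ.^ n ℕ.* suc v
    ≡⟨ ℕP.*-assoc B (suc v ℕ.^ n) (suc v) ⟩
  B ℕ.* (suc v ℕ.^ n ℕ.* suc v)
    ≡⟨ cong (B ℕ.*_) (ℕP.*-comm (suc v ℕ.^ n) (suc v)) ⟩
  B ℕ.* suc v ℕ.^ suc n ∎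
  where
  open ℕP.≤-Reasoning
  h : ℤ
  h = horner σ x n
  shuffle : ∀ v t B → v ℕ.* (suc v ℕ.* t ℕ.+ B) ℕ.+ B ≡ suc v ℕ.* (v ℕ.* t ℕ.+ B)
  shuffle = ℕ-Solver.solve-∀

∣horner∣≤∣x∣^n : ∀ σ x n v → 1 ≤ v → ∣ x ∣ ≡ suc v → (∀ i → i < n → ∣ σ i ∣ ≤ 1) → ∣ horner σ x n ∣ ≤ ∣ x ∣ ℕ.^ n
∣horner∣≤∣x∣^n σ x n v 1≤v ∣x∣≡1+v σ≤1 = begin
  ∣ horner σ x n ∣                    ≤⟨ ℕP.m≤n*m ∣ horner σ x n ∣ v {{ℕ.>-nonZero 1≤v}} ⟩
  v ℕ.* ∣ horner σ x n ∣              ≤⟨ ℕP.m≤m+n _ 1 ⟩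
  v ℕ.* ∣ horner σ x n ∣ ℕ.+ 1        ≤⟨ ∣horner∣≤ σ x n 1 v ∣x∣≡1+v σ≤1 ⟩
  1 ℕ.* suc v ℕ.^ n                   ≡⟨ ℕP.*-identityˡ _ ⟩
  suc v ℕ.^ n                         ≡⟨ cong (ℕ._^ n) ∣x∣≡1+v ⟨
  ∣ x ∣ ℕ.^ n                         ∎
  where open ℕP.≤-Reasoning

ℓ¹ : List ℤ → ℕ
ℓ¹ []       = 0
ℓ¹ (q ∷ qs) = ∣ q ∣ ℕ.+ ℓ¹ qs

∣weightedSum∣≤ : ∀ qs F B → (∀ j → j < length qs → ∣ F j ∣ ≤ B) → ∣ weightedSum qs F ∣ ≤ ℓ¹ qs ℕ.* B
∣weightedSum∣≤ []       F B F≤B = z≤n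
∣weightedSum∣≤ (q ∷ qs) F B F≤B = begin
  ∣ q ℤ.* F 0 ℤ.+ weightedSum qs (λ j → F (suc j)) ∣
    ≤⟨ ℤP.∣i+j∣≤∣i∣+∣j∣ (q ℤ.* F 0) _ ⟩
  ∣ q ℤ.* F 0 ∣ ℕ.+ ∣ weightedSum qs (λ j → F (suc j)) ∣
    ≤⟨ ℕP.+-mono-≤ (ℕP.≤-trans (ℕP.≤-reflexive (ℤP.abs-* q (F 0))) (ℕP.*-monoʳ-≤ ∣ q ∣ (F≤B 0 (s≤s z≤n))))
                   (∣weightedSum∣≤ qs (λ j → F (suc j)) B (λ j j<len → F≤B (suc j) (s≤s j<len))) ⟩
  ∣ q ∣ ℕ.* B ℕ.+ ℓ¹ qs ℕ.* B
    ≡⟨ ℕP.*-distribʳ-+ B ∣ q ∣ (ℓ¹ qs) ⟨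
  ℓ¹ (q ∷ qs) ℕ.* B ∎
  where open ℕP.≤-Reasoning

∣tailCoefficient∣≤ : ∀ qs σ m → (∀ i → ∣ σ i ∣ ≤ 1) → ∣ tailCoefficient qs σ m ∣ ≤ ℓ¹ qs
∣tailCoefficient∣≤ qs σ m σ≤1 =
  ℕP.≤-trans (∣weightedSum∣≤ qs (λ j → σ (j ℕ.+ m)) 1 (λ j _ → σ≤1 (j ℕ.+ m))) (ℕP.≤-reflexive (ℕP.*-identityʳ (ℓ¹ qs)))

∣polynomialPart∣≤ : ∀ qs σ x v d → length qs ≤ suc d → ∣ x ∣ ≡ suc v → (∀ i → ∣ σ i ∣ ≤ 1) →
  v ℕ.* ∣ polynomialPart qs σ x ∣ ≤ ℓ¹ qs ℕ.* suc v ℕ.^ d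
∣polynomialPart∣≤ qs σ x v d len≤1+d ∣x∣≡1+v σ≤1 = begin
  v ℕ.* ∣ weightedSum qs (horner σ x) ∣
    ≡⟨ ℤP.abs-* (+ v) (weightedSum qs (horner σ x)) ⟨
  ∣ + v ℤ.* weightedSum qs (horner σ x) ∣
    ≡⟨ cong ∣_∣ (weightedSum-*ˡ qs (+ v) (horner σ x)) ⟨
  ∣ weightedSum qs (λ j → + v ℤ.* horner σ x j) ∣
    ≤⟨ ∣weightedSum∣≤ qs _ (suc v ℕ.^ d) term≤ ⟩
  ℓ¹ qs ℕ.* suc v ℕ.^ d ∎
  where
  open ℕP.≤-Reasoning
  term≤ : ∀ j → j < length qs → ∣ + v ℤ.* horner σ x j ∣ ≤ suc v ℕ.^ d
  term≤ j j<len = begin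
    ∣ + v ℤ.* horner σ x j ∣          ≡⟨ ℤP.abs-* (+ v) (horner σ x j) ⟩
    v ℕ.* ∣ horner σ x j ∣            ≤⟨ ℕP.m≤m+n _ 1 ⟩
    v ℕ.* ∣ horner σ x j ∣ ℕ.+ 1      ≤⟨ ∣horner∣≤ σ x j 1 v ∣x∣≡1+v (λ i _ → σ≤1 i) ⟩
    1 ℕ.* suc v ℕ.^ j                 ≡⟨ ℕP.*-identityˡ _ ⟩
    suc v ℕ.^ j                       ≤⟨ ℕP.^-monoʳ-≤ (suc v) (ℕP.≤-pred (ℕP.≤-trans j<len len≤1+d)) ⟩
    suc v ℕ.^ d                       ∎

weightedSum-map+ : ∀ cs f → ∃[ s ] weightedSum (map +_ cs) (λ j → + f j) ≡ + s
weightedSum-map+ []       f = 0 , refl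
weightedSum-map+ (c ∷ cs) f with weightedSum-map+ cs (λ j → f (suc j))
... | s , eq = c ℕ.* f 0 ℕ.+ s ,
  trans (cong₂ ℤ._+_ (sym (ℤP.pos-* c (f 0))) eq) (sym (ℤP.pos-+ (c ℕ.* f 0) s))

polynomial-map+ : ∀ cs u → ∃[ s ] polynomial (map +_ cs) (+ u) ≡ + s
polynomial-map+ cs u with weightedSum-map+ cs (u ℕ.^_)
... | s , eq = s , trans (weightedSum-cong (map +_ cs) (+-^ℤ u)) eq

Qhat9-bounds : ∀ w → 2 ≤ w → ∃[ q ] (Qhat9 (+ w) ≡ + q × w ℕ.^ 9 ≤ q × q ≤ 2 ℕ.* w ℕ.^ 9)
Qhat9-bounds w 2≤w = bounds (polynomial-map+ Qhat9-lowerSlack u) (polynomial-map+ Qhat9-upperSlack u)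
  where
  u : ℕ
  u = w ℕ.∸ 2
  +w≡2+u : + w ≡ + 2 ℤ.+ + u
  +w≡2+u = trans (cong +_ (sym (ℕP.m+[n∸m]≡n 2≤w))) (ℤP.pos-+ 2 u)
  bounds : ∃[ s ] polynomial (map +_ Qhat9-lowerSlack) (+ u) ≡ + s →
           ∃[ s′ ] polynomial (map +_ Qhat9-upperSlack) (+ u) ≡ + s′ →
           ∃[ q ] (Qhat9 (+ w) ≡ + q × w ℕ.^ 9 ≤ q × q ≤ 2 ℕ.* w ℕ.^ 9)
  bounds (s , lower≡s) (s′ , upper≡s′) = w ℕ.^ 9 ℕ.+ s , Q≡ , ℕP.m≤m+n (w ℕ.^ 9) s , Q≤
    where
    Q≡ : Qhat9 (+ w) ≡ + (w ℕ.^ 9 ℕ.+ s)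
    Q≡ = begin
      Qhat9 (+ w)                                                  ≡⟨ cong Qhat9 +w≡2+u ⟩
      Qhat9 (+ 2 ℤ.+ + u)                                          ≡⟨ Qhat9-shift-lower (+ u) ⟩
      (+ 2 ℤ.+ + u) ^ℤ 9 ℤ.+ polynomial (map +_ Qhat9-lowerSlack) (+ u)
        ≡⟨ cong (λ W → W ^ℤ 9 ℤ.+ polynomial (map +_ Qhat9-lowerSlack) (+ u)) (sym +w≡2+u) ⟩
      (+ w) ^ℤ 9 ℤ.+ polynomial (map +_ Qhat9-lowerSlack) (+ u)    ≡⟨ cong₂ ℤ._+_ (+-^ℤ w 9) lower≡s ⟩
      + (w ℕ.^ 9) ℤ.+ + s                                          ≡⟨ ℤP.pos-+ (w ℕ.^ 9) s ⟨
      + (w ℕ.^ 9 ℕ.+ s)                                            ∎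
      where open ≡-Reasoning
    Q+s′≡2w⁹ : w ℕ.^ 9 ℕ.+ s ℕ.+ s′ ≡ 2 ℕ.* w ℕ.^ 9
    Q+s′≡2w⁹ = ℤP.+-injective (begin
      + (w ℕ.^ 9 ℕ.+ s ℕ.+ s′)                                     ≡⟨ ℤP.pos-+ (w ℕ.^ 9 ℕ.+ s) s′ ⟩
      + (w ℕ.^ 9 ℕ.+ s) ℤ.+ + s′                                   ≡⟨ cong₂ ℤ._+_ Q≡ upper≡s′ ⟨
      Qhat9 (+ w) ℤ.+ polynomial (map +_ Qhat9-upperSlack) (+ u)
        ≡⟨ cong (λ W → Qhat9 W ℤ.+ polynomial (map +_ Qhat9-upperSlack) (+ u)) +w≡2+u ⟩
      Qhat9 (+ 2 ℤ.+ + u) ℤ.+ polynomial (map +_ Qhat9-upperSlack) (+ u)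
        ≡⟨ Qhat9-shift-upper (+ u) ⟩
      + 2 ℤ.* (+ 2 ℤ.+ + u) ^ℤ 9                                   ≡⟨ cong (λ W → + 2 ℤ.* W ^ℤ 9) (sym +w≡2+u) ⟩
      + 2 ℤ.* (+ w) ^ℤ 9                                           ≡⟨ cong (+ 2 ℤ.*_) (+-^ℤ w 9) ⟩
      + 2 ℤ.* + (w ℕ.^ 9)                                          ≡⟨ ℤP.pos-* 2 (w ℕ.^ 9) ⟨
      + (2 ℕ.* w ℕ.^ 9)                                            ∎)
      where open ≡-Reasoning
    Q≤ : w ℕ.^ 9 ℕ.+ s ≤ 2 ℕ.* w ℕ.^ 9
    Q≤ = ℕP.≤-trans (ℕP.m≤m+n _ s′) (ℕP.≤-reflexive Q+s′≡2w⁹)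

-- 41 = 2 · (10 + 10) + 1: since w ≤ 2ω the Padé remainder contributes 40, the tail u the remaining 1.
error-estimate : ∀ {e X p g h q u a ω w w⁹} → 1 ≤ ω → w ≤ 2 ℕ.* ω → 1 ≤ a →
  ω ℕ.* g ≤ 10 ℕ.* (a ℕ.* w⁹) → ω ℕ.* h ≤ 10 ℕ.* w⁹ → p ≤ w → u ≤ X → w⁹ ≤ q →
  e ≤ X ℕ.* p ℕ.* (g ℕ.+ h) ℕ.+ q ℕ.* u → e ≤ 41 ℕ.* (X ℕ.* q ℕ.* a)
error-estimate {e} {X} {p} {g} {h} {q} {u} {a} {ω} {w} {w⁹} 1≤ω w≤2ω 1≤a ωg≤ ωh≤ p≤w u≤X w⁹≤q e≤ =
  ℕP.*-cancelˡ-≤ ω {{ℕ.>-nonZero 1≤ω}} (begin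
    ω ℕ.* e
      ≤⟨ ℕP.*-monoʳ-≤ ω e≤ ⟩
    ω ℕ.* (X ℕ.* p ℕ.* (g ℕ.+ h) ℕ.+ q ℕ.* u)
      ≡⟨ distribute ω X p g h q u ⟩
    X ℕ.* p ℕ.* (ω ℕ.* g ℕ.+ ω ℕ.* h) ℕ.+ ω ℕ.* q ℕ.* u
      ≤⟨ ℕP.+-mono-≤ (ℕP.*-mono-≤ (ℕP.*-monoʳ-≤ X (ℕP.≤-trans p≤w w≤2ω)) (ℕP.+-mono-≤ ωg≤qa ωh≤qa))
                     (ℕP.*-monoʳ-≤ (ω ℕ.* q) (ℕP.≤-trans u≤X (ℕP.m≤m*n X a {{ℕ.>-nonZero 1≤a}}))) ⟩
    X ℕ.* (2 ℕ.* ω) ℕ.* (10 ℕ.* (q ℕ.* a) ℕ.+ 10 ℕ.* (q ℕ.* a)) ℕ.+ ω ℕ.* q ℕ.* (X ℕ.* a)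
      ≡⟨ collect ω X q a ⟩
    ω ℕ.* (41 ℕ.* (X ℕ.* q ℕ.* a)) ∎)
  where
  open ℕP.≤-Reasoning
  ωg≤qa : ω ℕ.* g ≤ 10 ℕ.* (q ℕ.* a)
  ωg≤qa = ℕP.≤-trans ωg≤ (ℕP.*-monoʳ-≤ 10 (ℕP.≤-trans (ℕP.*-monoʳ-≤ a w⁹≤q) (ℕP.≤-reflexive (ℕP.*-comm a q))))
  ωh≤qa : ω ℕ.* h ≤ 10 ℕ.* (q ℕ.* a)
  ωh≤qa = ℕP.≤-trans ωh≤ (ℕP.*-monoʳ-≤ 10 (ℕP.≤-trans w⁹≤q (ℕP.m≤m*n q a {{ℕ.>-nonZero 1≤a}})))
  distribute : ∀ ω X p g h q u →
    ω ℕ.* (X ℕ.* p ℕ.* (g ℕ.+ h) ℕ.+ q ℕ.* u) ≡ X ℕ.* p ℕ.* (ω ℕ.* g ℕ.+ ω ℕ.* h) ℕ.+ ω ℕ.* q ℕ.* u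
  distribute = ℕ-Solver.solve-∀
  collect : ∀ ω X q a →
    X ℕ.* (2 ℕ.* ω) ℕ.* (10 ℕ.* (q ℕ.* a) ℕ.+ 10 ℕ.* (q ℕ.* a)) ℕ.+ ω ℕ.* q ℕ.* (X ℕ.* a)
      ≡ ω ℕ.* (41 ℕ.* (X ℕ.* q ℕ.* a))
  collect = ℕ-Solver.solve-∀

divMod-≥ : ∀ k M N .{{_ : ℕ.NonZero M}} → k ℕ.* M ≤ N → ∃[ t ] ∃[ r ] (r < M × N ≡ (t ℕ.+ k) ℕ.* M ℕ.+ r)
divMod-≥ k M N kM≤N = N / M ℕ.∸ k , N % M , m%n<n N M , (begin
  N                                    ≡⟨ m≡m%n+[m/n]*n N M ⟩
  N % M ℕ.+ N / M ℕ.* M                ≡⟨ ℕP.+-comm (N % M) _ ⟩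
  N / M ℕ.* M ℕ.+ N % M                ≡⟨ cong (λ t → t ℕ.* M ℕ.+ N % M) (ℕP.m∸n+n≡m k≤N/M) ⟨
  (N / M ℕ.∸ k ℕ.+ k) ℕ.* M ℕ.+ N % M  ∎)
  where
  open ≡-Reasoning
  k≤N/M : k ≤ N / M
  k≤N/M = ℕP.≤-trans (ℕP.≤-reflexive (sym (m*n/n≡m k M))) (/-monoˡ-≤ M kM≤N)

frac-+ : ∀ p d .{{_ : ℕ.NonZero d}} → frac p (+ d) ≡ p ℚ./ d
frac-+ p (suc d) = refl

toℚᵘ-/ : ∀ p d .{{_ : ℕ.NonZero d}} → toℚᵘ (p ℚ./ d) ℚᵘ.≃ p /ᵘ d
toℚᵘ-/ p (suc d) = ℚP.toℚᵘ-fromℚᵘ (mkℚᵘ p d)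

/ᵘ-+-/ᵘ : ∀ p r z A B .{{_ : ℕ.NonZero A}} .{{_ : ℕ.NonZero B}} → B ≡ z ℕ.* A →
  p /ᵘ A ℚᵘ.+ r /ᵘ B ℚᵘ.≃ (+ z ℤ.* p ℤ.+ r) /ᵘ B
/ᵘ-+-/ᵘ p r z (suc A) (suc B) B≡zA = *≡* (begin
  (p ℤ.* + suc B ℤ.+ r ℤ.* + suc A) ℤ.* + suc B
    ≡⟨ cong (λ b → (p ℤ.* b ℤ.+ r ℤ.* + suc A) ℤ.* b) +B≡zA ⟩
  (p ℤ.* (+ z ℤ.* + suc A) ℤ.+ r ℤ.* + suc A) ℤ.* (+ z ℤ.* + suc A)
    ≡⟨ shuffle p r (+ z) (+ suc A) ⟩
  (+ z ℤ.* p ℤ.+ r) ℤ.* (+ suc A ℤ.* (+ z ℤ.* + suc A))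
    ≡⟨ cong (λ b → (+ z ℤ.* p ℤ.+ r) ℤ.* (+ suc A ℤ.* b)) (sym +B≡zA) ⟩
  (+ z ℤ.* p ℤ.+ r) ℤ.* (+ suc A ℤ.* + suc B)
    ≡⟨ cong ((+ z ℤ.* p ℤ.+ r) ℤ.*_) (sym (ℤP.pos-* (suc A) (suc B))) ⟩
  (+ z ℤ.* p ℤ.+ r) ℤ.* + (suc A ℕ.* suc B) ∎)
  where
  open ≡-Reasoning
  +B≡zA : + suc B ≡ + z ℤ.* + suc A
  +B≡zA = trans (cong +_ B≡zA) (ℤP.pos-* z (suc A))
  shuffle : ∀ p r z a → (p ℤ.* (z ℤ.* a) ℤ.+ r ℤ.* a) ℤ.* (z ℤ.* a) ≡ (z ℤ.* p ℤ.+ r) ℤ.* (a ℤ.* (z ℤ.* a))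
  shuffle = ℤ-Solver.solve-∀

S≃horner/z^N : ∀ z N .{{_ : ℕ.NonZero z}} → toℚᵘ (S (+ z) N) ℚᵘ.≃ (horner sgn (+ z) N /ᵘ z ℕ.^ N) {{ℕP.m^n≢0 z N}}
S≃horner/z^N z zero = ℚᵘP.≃-refl
S≃horner/z^N z (suc N) = begin
  toℚᵘ (S (+ z) N ℚ.+ frac (sgn N) ((+ z) ^ℤ suc N))
    ≈⟨ ℚP.toℚᵘ-homo-+ (S (+ z) N) _ ⟩
  toℚᵘ (S (+ z) N) ℚᵘ.+ toℚᵘ (frac (sgn N) ((+ z) ^ℤ suc N))
    ≈⟨ ℚᵘP.+-cong (S≃horner/z^N z N) last-term ⟩
  (horner sgn (+ z) N /ᵘ z ℕ.^ N) {{z^N≢0}} ℚᵘ.+ (sgn N /ᵘ z ℕ.^ suc N) {{z^1+N≢0}}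
    ≈⟨ /ᵘ-+-/ᵘ (horner sgn (+ z) N) (sgn N) z (z ℕ.^ N) (z ℕ.^ suc N) {{z^N≢0}} {{z^1+N≢0}} refl ⟩
  (horner sgn (+ z) (suc N) /ᵘ z ℕ.^ suc N) {{z^1+N≢0}} ∎
  where
  open ℚᵘP.≃-Reasoning
  z^N≢0 : ℕ.NonZero (z ℕ.^ N)
  z^N≢0 = ℕP.m^n≢0 z N
  z^1+N≢0 : ℕ.NonZero (z ℕ.^ suc N)
  z^1+N≢0 = ℕP.m^n≢0 z (suc N)
  last-term : toℚᵘ (frac (sgn N) ((+ z) ^ℤ suc N)) ℚᵘ.≃ (sgn N /ᵘ z ℕ.^ suc N) {{z^1+N≢0}}
  last-term = ℚᵘP.≃-trans (ℚP.toℚᵘ-cong (trans (cong (frac (sgn N)) (+-^ℤ z (suc N))) (frac-+ (sgn N) (z ℕ.^ suc N) {{z^1+N≢0}})))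
                          (toℚᵘ-/ (sgn N) (z ℕ.^ suc N) {{z^1+N≢0}})

∣/ᵘ-/ᵘ∣≤ : ∀ a b c A B D .{{_ : ℕ.NonZero A}} .{{_ : ℕ.NonZero B}} .{{_ : ℕ.NonZero D}} →
  ∣ a ℤ.* + B ℤ.- b ℤ.* + A ∣ ℕ.* D ≤ c ℕ.* (A ℕ.* B) →
  ℚᵘ.∣ a /ᵘ A ℚᵘ.- b /ᵘ B ∣ ℚᵘ.≤ (+ c /ᵘ 1) ℚᵘ.* (+ 1 /ᵘ D)
∣/ᵘ-/ᵘ∣≤ a b c (suc A) (suc B) (suc D) cross = *≤* (begin
  + ∣ a ℤ.* + suc B ℤ.+ ℤ.- b ℤ.* + suc A ∣ ℤ.* + suc (D ℕ.+ 0)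
    ≡⟨ cong₂ (λ e d → + ∣ e ∣ ℤ.* + suc d) (neg-* a b (+ suc B) (+ suc A)) (ℕP.+-identityʳ D) ⟩
  + ∣ a ℤ.* + suc B ℤ.- b ℤ.* + suc A ∣ ℤ.* + suc D
    ≡⟨ ℤP.pos-* ∣ a ℤ.* + suc B ℤ.- b ℤ.* + suc A ∣ (suc D) ⟨
  + (∣ a ℤ.* + suc B ℤ.- b ℤ.* + suc A ∣ ℕ.* suc D)
    ≤⟨ ℤ.+≤+ cross ⟩
  + (c ℕ.* (suc A ℕ.* suc B))
    ≡⟨ ℤP.pos-* c _ ⟩
  + c ℤ.* + (suc A ℕ.* suc B)
    ≡⟨ cong (ℤ._* + (suc A ℕ.* suc B)) (ℤP.*-identityʳ (+ c)) ⟨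
  (+ c ℤ.* + 1) ℤ.* + (suc A ℕ.* suc B) ∎)
  where
  open ℤP.≤-Reasoning
  neg-* : ∀ a b x y → a ℤ.* x ℤ.+ ℤ.- b ℤ.* y ≡ a ℤ.* x ℤ.- b ℤ.* y
  neg-* = ℤ-Solver.solve-∀

∣-∣≤-cross : ∀ x a b c A B D .{{_ : ℕ.NonZero A}} .{{_ : ℕ.NonZero B}} .{{_ : ℕ.NonZero D}} →
  toℚᵘ x ℚᵘ.≃ a /ᵘ A →
  ∣ a ℤ.* + B ℤ.- b ℤ.* + A ∣ ℕ.* D ≤ c ℕ.* (A ℕ.* B) →
  ℚ.∣ x ℚ.- b ℚ./ B ∣ ℚ.≤ (+ c ℚ./ 1) ℚ.* (+ 1 ℚ./ D)
∣-∣≤-cross x a b c A B D x≃a/A cross = ℚP.toℚᵘ-cancel-≤ (begin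
  toℚᵘ ℚ.∣ x ℚ.- b ℚ./ B ∣
    ≃⟨ ℚP.toℚᵘ-homo-∣-∣ (x ℚ.- b ℚ./ B) ⟩
  ℚᵘ.∣ toℚᵘ (x ℚ.- b ℚ./ B) ∣
    ≃⟨ ℚᵘP.∣-∣-cong (ℚᵘP.≃-trans (ℚP.toℚᵘ-homo-+ x (ℚ.- (b ℚ./ B)))
         (ℚᵘP.+-cong x≃a/A (ℚᵘP.≃-trans (ℚP.toℚᵘ-homo‿- (b ℚ./ B)) (ℚᵘP.-‿cong (toℚᵘ-/ b B))))) ⟩
  ℚᵘ.∣ a /ᵘ A ℚᵘ.- b /ᵘ B ∣
    ≤⟨ ∣/ᵘ-/ᵘ∣≤ a b c A B D cross ⟩
  (+ c /ᵘ 1) ℚᵘ.* (+ 1 /ᵘ D)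
    ≃⟨ ℚᵘP.*-cong (toℚᵘ-/ (+ c) 1) (toℚᵘ-/ (+ 1) D) ⟨
  toℚᵘ (+ c ℚ./ 1) ℚᵘ.* toℚᵘ (+ 1 ℚ./ D)
    ≃⟨ ℚP.toℚᵘ-homo-* (+ c ℚ./ 1) (+ 1 ℚ./ D) ⟨
  toℚᵘ ((+ c ℚ./ 1) ℚ.* (+ 1 ℚ./ D)) ∎)
  where open ℚᵘP.≤-Reasoning

C₄₁ : ℚ
C₄₁ = + 41 ℚ./ 1

module Approximation (z : ℕ) (2≤z : 2 ≤ z) (n : ℕ) where

  y M w : ℕ
  y = z ℕ.∸ 1
  M = 2 ℕ.^ suc n
  w = z ℕ.^ M

  W Π : ℤ
  W = (+ z) ^ℤ M
  Π = prodFactors n (+ z)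

  z≡1+y : z ≡ suc y
  z≡1+y = sym (ℕP.m+[n∸m]≡n (ℕP.≤-trans (s≤s z≤n) 2≤z))

  1≤y : 1 ≤ y
  1≤y = ℕP.≤-pred (subst (2 ≤_) z≡1+y 2≤z)

  instance
    z≢0 : ℕ.NonZero z
    z≢0 = ℕ.>-nonZero (ℕP.≤-trans (s≤s z≤n) 2≤z)
    M≢0 : ℕ.NonZero M
    M≢0 = ℕP.m^n≢0 2 (suc n)

  W≡+w : W ≡ + w
  W≡+w = +-^ℤ z M

  2≤w : 2 ≤ w
  2≤w = ℕP.≤-trans 2≤z (ℕP.≤-trans (ℕP.≤-reflexive (sym (ℕP.*-identityʳ z))) (ℕP.^-monoʳ-≤ z (ℕP.m^n>0 2 (suc n))))

  ω : ℕ
  ω = w ℕ.∸ 1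

  w≡1+ω : w ≡ suc ω
  w≡1+ω = sym (ℕP.m+[n∸m]≡n (ℕP.≤-trans (s≤s z≤n) 2≤w))

  ∣W∣≡1+ω : ∣ W ∣ ≡ suc ω
  ∣W∣≡1+ω = trans (cong ∣_∣ W≡+w) w≡1+ω

  1≤ω : 1 ≤ ω
  1≤ω = ℕP.≤-pred (subst (2 ≤_) w≡1+ω 2≤w)

  w≤2ω : w ≤ 2 ℕ.* ω
  w≤2ω = subst (_≤ 2 ℕ.* ω) (sym w≡1+ω) (ℕP.+-mono-≤ 1≤ω (ℕP.m≤m+n ω 0))

  q : ℕ
  q = proj₁ (Qhat9-bounds w 2≤w)

  Qtilde≡q : Qtilde n (+ z) ≡ + q
  Qtilde≡q = trans (cong Qhat9 W≡+w) (proj₁ (proj₂ (Qhat9-bounds w 2≤w)))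

  w⁹≤q : w ℕ.^ 9 ≤ q
  w⁹≤q = proj₁ (proj₂ (proj₂ (Qhat9-bounds w 2≤w)))

  q≤2w⁹ : q ≤ 2 ℕ.* w ℕ.^ 9
  q≤2w⁹ = proj₂ (proj₂ (proj₂ (Qhat9-bounds w 2≤w)))

  instance
    q≢0 : ℕ.NonZero q
    q≢0 = ℕ.>-nonZero (ℕP.≤-trans (ℕP.m^n>0 w {{ℕ.>-nonZero (ℕP.≤-trans (s≤s z≤n) 2≤w)}} 9) w⁹≤q)

  w⁹≡z^[18·2^n] : w ℕ.^ 9 ≡ z ℕ.^ (18 ℕ.* 2 ℕ.^ n)
  w⁹≡z^[18·2^n] = trans (ℕP.^-*-assoc z M 9) (cong (z ℕ.^_) (M*9 (2 ℕ.^ n)))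
    where
    M*9 : ∀ p → 2 ℕ.* p ℕ.* 9 ≡ 18 ℕ.* p
    M*9 = ℕ-Solver.solve-∀

  w¹⁸≡z^[36·2^n] : w ℕ.^ 18 ≡ z ℕ.^ (36 ℕ.* 2 ℕ.^ n)
  w¹⁸≡z^[36·2^n] = trans (ℕP.^-*-assoc z M 18) (cong (z ℕ.^_) (M*18 (2 ℕ.^ n)))
    where
    M*18 : ∀ p → 2 ℕ.* p ℕ.* 18 ≡ 36 ℕ.* p
    M*18 = ℕ-Solver.solve-∀

  Qtilde-bound : Qtilde n (+ z) ℤ.≤ + 2 ℤ.* (+ z) ^ℤ (18 ℕ.* 2 ℕ.^ n)
  Qtilde-bound = subst₂ ℤ._≤_ (sym Qtilde≡q) +2w⁹≡ (ℤ.+≤+ q≤2w⁹)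
    where
    +2w⁹≡ : + (2 ℕ.* w ℕ.^ 9) ≡ + 2 ℤ.* (+ z) ^ℤ (18 ℕ.* 2 ℕ.^ n)
    +2w⁹≡ = trans (ℤP.pos-* 2 (w ℕ.^ 9))
                  (cong (+ 2 ℤ.*_) (trans (cong +_ w⁹≡z^[18·2^n]) (sym (+-^ℤ z (18 ℕ.* 2 ℕ.^ n)))))

  ∣Π∣≤w : ∣ Π ∣ ≤ w
  ∣Π∣≤w = subst (λ h → ∣ h ∣ ≤ w) (horner-sgn-2^[1+n] n (+ z))
                (∣horner∣≤∣x∣^n sgn (+ z) M y 1≤y z≡1+y (λ i _ → ∣sgn∣≤1 i))

  module PartialSum (t r : ℕ) (r<M : r < M) where

    -- Lengths are written t + 18, never 18 + t: a length reducing to suc (suc …) lets Agda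
    -- unfold horner and sgn while comparing terms, which exhausts memory.
    K N : ℕ
    K = t ℕ.+ 18
    N = K ℕ.* M ℕ.+ r

    T′ G Pₖ U E : ℤ
    T′ = horner sgn W K
    G  = horner (tailCoefficient Qhat9-coefficients sgn) W K
    Pₖ = polynomialPart Qhat9-coefficients (λ i → sgn (K ℕ.+ i)) W
    U  = horner (λ i → sgn (K ℕ.* M ℕ.+ i)) (+ z) r
    E  = horner sgn (+ z) N ℤ.* + q ℤ.- Ptilde n (+ z) ℤ.* + (z ℕ.^ N)

    horner-N : horner sgn (+ z) N ≡ (+ z) ^ℤ r ℤ.* (Π ℤ.* T′) ℤ.+ U
    horner-N = trans (horner-+ sgn (+ z) (K ℕ.* M) r)
      (cong (λ h → (+ z) ^ℤ r ℤ.* h ℤ.+ U)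
        (trans (horner-sgn-*2^k (suc n) (+ z) K) (cong (ℤ._* T′) (horner-sgn-2^[1+n] n (+ z)))))

    +z^N≡ : + (z ℕ.^ N) ≡ (+ z) ^ℤ r ℤ.* W ^ℤ K
    +z^N≡ = begin
      + (z ℕ.^ N)                         ≡⟨ +-^ℤ z N ⟨
      (+ z) ^ℤ (K ℕ.* M ℕ.+ r)            ≡⟨ ^ℤ-+ (+ z) (K ℕ.* M) r ⟩
      (+ z) ^ℤ (K ℕ.* M) ℤ.* (+ z) ^ℤ r   ≡⟨ cong (ℤ._* (+ z) ^ℤ r) (^ℤ-* (+ z) K M) ⟩
      W ^ℤ K ℤ.* (+ z) ^ℤ r               ≡⟨ ℤP.*-comm (W ^ℤ K) ((+ z) ^ℤ r) ⟩
      (+ z) ^ℤ r ℤ.* W ^ℤ K               ∎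
      where open ≡-Reasoning

    padé : Qhat9 W ℤ.* T′ ℤ.+ Pₖ ≡ W ^ℤ K ℤ.* Phat9 W ℤ.+ G
    padé = begin
      Qhat9 W ℤ.* T′ ℤ.+ Pₖ
        ≡⟨ cong (λ Q → Q ℤ.* T′ ℤ.+ Pₖ) (Qhat9≡polynomial W) ⟩
      polynomial Qhat9-coefficients W ℤ.* T′ ℤ.+ Pₖ
        ≡⟨ polynomial*horner Qhat9-coefficients sgn W K ⟩
      W ^ℤ K ℤ.* polynomialPart Qhat9-coefficients sgn W ℤ.+ G
        ≡⟨ cong (λ P → W ^ℤ K ℤ.* P ℤ.+ G) (Phat9≡polynomialPart W) ⟨
      W ^ℤ K ℤ.* Phat9 W ℤ.+ G ∎
      where open ≡-Reasoning

    E≡ : E ≡ (+ z) ^ℤ r ℤ.* Π ℤ.* (G ℤ.- Pₖ) ℤ.+ + q ℤ.* U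
    E≡ = begin
      horner sgn (+ z) N ℤ.* + q ℤ.- Π ℤ.* Phat9 W ℤ.* + (z ℕ.^ N)
        ≡⟨ cong₂ (λ h Z → h ℤ.* + q ℤ.- Π ℤ.* Phat9 W ℤ.* Z) horner-N +z^N≡ ⟩
      (X ℤ.* (Π ℤ.* T′) ℤ.+ U) ℤ.* + q ℤ.- Π ℤ.* Phat9 W ℤ.* (X ℤ.* W ^ℤ K)
        ≡⟨ cong (λ Q → (X ℤ.* (Π ℤ.* T′) ℤ.+ U) ℤ.* Q ℤ.- Π ℤ.* Phat9 W ℤ.* (X ℤ.* W ^ℤ K)) Qtilde≡q ⟨
      (X ℤ.* (Π ℤ.* T′) ℤ.+ U) ℤ.* Qhat9 W ℤ.- Π ℤ.* Phat9 W ℤ.* (X ℤ.* W ^ℤ K)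
        ≡⟨ expand X Π T′ U (Qhat9 W) (Phat9 W) (W ^ℤ K) Pₖ ⟩
      X ℤ.* Π ℤ.* ((Qhat9 W ℤ.* T′ ℤ.+ Pₖ) ℤ.- (W ^ℤ K ℤ.* Phat9 W ℤ.+ Pₖ)) ℤ.+ Qhat9 W ℤ.* U
        ≡⟨ cong (λ e → X ℤ.* Π ℤ.* (e ℤ.- (W ^ℤ K ℤ.* Phat9 W ℤ.+ Pₖ)) ℤ.+ Qhat9 W ℤ.* U) padé ⟩
      X ℤ.* Π ℤ.* ((W ^ℤ K ℤ.* Phat9 W ℤ.+ G) ℤ.- (W ^ℤ K ℤ.* Phat9 W ℤ.+ Pₖ)) ℤ.+ Qhat9 W ℤ.* U
        ≡⟨ cancel X Π (W ^ℤ K ℤ.* Phat9 W) G Pₖ (Qhat9 W ℤ.* U) ⟩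
      X ℤ.* Π ℤ.* (G ℤ.- Pₖ) ℤ.+ Qhat9 W ℤ.* U
        ≡⟨ cong (λ Q → X ℤ.* Π ℤ.* (G ℤ.- Pₖ) ℤ.+ Q ℤ.* U) Qtilde≡q ⟩
      X ℤ.* Π ℤ.* (G ℤ.- Pₖ) ℤ.+ + q ℤ.* U ∎
      where
      open ≡-Reasoning
      X : ℤ
      X = (+ z) ^ℤ r
      expand : ∀ X Π T U Q P Wᴷ Pₖ →
        (X ℤ.* (Π ℤ.* T) ℤ.+ U) ℤ.* Q ℤ.- Π ℤ.* P ℤ.* (X ℤ.* Wᴷ)
          ≡ X ℤ.* Π ℤ.* ((Q ℤ.* T ℤ.+ Pₖ) ℤ.- (Wᴷ ℤ.* P ℤ.+ Pₖ)) ℤ.+ Q ℤ.* U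
      expand = ℤ-Solver.solve-∀
      cancel : ∀ X Π A G Pₖ B → X ℤ.* Π ℤ.* ((A ℤ.+ G) ℤ.- (A ℤ.+ Pₖ)) ℤ.+ B ≡ X ℤ.* Π ℤ.* (G ℤ.- Pₖ) ℤ.+ B
      cancel = ℤ-Solver.solve-∀

    ∣U∣≤z^r : ∣ U ∣ ≤ z ℕ.^ r
    ∣U∣≤z^r = ∣horner∣≤∣x∣^n (λ i → sgn (K ℕ.* M ℕ.+ i)) (+ z) r y 1≤y z≡1+y (λ i _ → ∣sgn∣≤1 (K ℕ.* M ℕ.+ i))

    ω∣Pₖ∣≤ : ω ℕ.* ∣ Pₖ ∣ ≤ 10 ℕ.* w ℕ.^ 9
    ω∣Pₖ∣≤ = subst (λ b → ω ℕ.* ∣ Pₖ ∣ ≤ 10 ℕ.* b ℕ.^ 9) (sym w≡1+ω)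
               (∣polynomialPart∣≤ Qhat9-coefficients (λ i → sgn (K ℕ.+ i)) W ω 9 ℕP.≤-refl ∣W∣≡1+ω (λ i → ∣sgn∣≤1 (K ℕ.+ i)))

    c c₉ : ℕ → ℤ
    c = tailCoefficient Qhat9-coefficients sgn
    c₉ i = c (9 ℕ.+ i)
    G≡tail : G ≡ horner c₉ W (t ℕ.+ 9)
    G≡tail = begin
      horner c W (t ℕ.+ 18)                                         ≡⟨ cong (horner c W) t+18≡9+[t+9] ⟩
      horner c W (9 ℕ.+ (t ℕ.+ 9))                                  ≡⟨ horner-+ c W 9 (t ℕ.+ 9) ⟩
      W ^ℤ (t ℕ.+ 9) ℤ.* horner c W 9 ℤ.+ horner c₉ W (t ℕ.+ 9)     ≡⟨ cong (λ h → W ^ℤ (t ℕ.+ 9) ℤ.* h ℤ.+ horner c₉ W (t ℕ.+ 9)) (horner-tailCoefficient-sgn-9 W) ⟩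
      W ^ℤ (t ℕ.+ 9) ℤ.* + 0 ℤ.+ horner c₉ W (t ℕ.+ 9)              ≡⟨ cong (ℤ._+ horner c₉ W (t ℕ.+ 9)) (ℤP.*-zeroʳ (W ^ℤ (t ℕ.+ 9))) ⟩
      + 0 ℤ.+ horner c₉ W (t ℕ.+ 9)                                 ≡⟨ ℤP.+-identityˡ (horner c₉ W (t ℕ.+ 9)) ⟩
      horner c₉ W (t ℕ.+ 9)                                         ∎
      where
      open ≡-Reasoning
      t+18≡9+[t+9] : t ℕ.+ 18 ≡ 9 ℕ.+ (t ℕ.+ 9)
      t+18≡9+[t+9] = trans (ℕP.+-comm t 18) (cong (9 ℕ.+_) (ℕP.+-comm 9 t))

    ω∣G∣≤ : ω ℕ.* ∣ G ∣ ≤ 10 ℕ.* (w ℕ.^ t ℕ.* w ℕ.^ 9)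
    ω∣G∣≤ = begin
      ω ℕ.* ∣ G ∣                              ≡⟨ cong (λ g → ω ℕ.* ∣ g ∣) G≡tail ⟩
      ω ℕ.* ∣ horner c₉ W (t ℕ.+ 9) ∣          ≤⟨ ℕP.m≤m+n (ω ℕ.* ∣ horner c₉ W (t ℕ.+ 9) ∣) 10 ⟩
      ω ℕ.* ∣ horner c₉ W (t ℕ.+ 9) ∣ ℕ.+ 10   ≤⟨ ∣horner∣≤ c₉ W (t ℕ.+ 9) 10 ω ∣W∣≡1+ω c₉≤10 ⟩
      10 ℕ.* suc ω ℕ.^ (t ℕ.+ 9)               ≡⟨ cong (λ b → 10 ℕ.* b ℕ.^ (t ℕ.+ 9)) w≡1+ω ⟨
      10 ℕ.* w ℕ.^ (t ℕ.+ 9)                   ≡⟨ cong (10 ℕ.*_) (ℕP.^-distribˡ-+-* w t 9) ⟩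
      10 ℕ.* (w ℕ.^ t ℕ.* w ℕ.^ 9)             ∎
      where
      open ℕP.≤-Reasoning
      c₉≤10 : ∀ i → i < t ℕ.+ 9 → ∣ c₉ i ∣ ≤ 10
      c₉≤10 i _ = ∣tailCoefficient∣≤ Qhat9-coefficients sgn (9 ℕ.+ i) ∣sgn∣≤1

    ∣E∣≤ : ∣ E ∣ ≤ z ℕ.^ r ℕ.* ∣ Π ∣ ℕ.* (∣ G ∣ ℕ.+ ∣ Pₖ ∣) ℕ.+ q ℕ.* ∣ U ∣
    ∣E∣≤ = begin
      ∣ E ∣
        ≡⟨ cong ∣_∣ E≡ ⟩
      ∣ (+ z) ^ℤ r ℤ.* Π ℤ.* (G ℤ.- Pₖ) ℤ.+ + q ℤ.* U ∣
        ≤⟨ ℤP.∣i+j∣≤∣i∣+∣j∣ ((+ z) ^ℤ r ℤ.* Π ℤ.* (G ℤ.- Pₖ)) (+ q ℤ.* U) ⟩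
      ∣ (+ z) ^ℤ r ℤ.* Π ℤ.* (G ℤ.- Pₖ) ∣ ℕ.+ ∣ + q ℤ.* U ∣
        ≡⟨ cong₂ ℕ._+_ (trans (ℤP.abs-* ((+ z) ^ℤ r ℤ.* Π) (G ℤ.- Pₖ)) (cong (ℕ._* ∣ G ℤ.- Pₖ ∣) ∣z^rΠ∣)) (ℤP.abs-* (+ q) U) ⟩
      z ℕ.^ r ℕ.* ∣ Π ∣ ℕ.* ∣ G ℤ.- Pₖ ∣ ℕ.+ q ℕ.* ∣ U ∣
        ≤⟨ ℕP.+-monoˡ-≤ (q ℕ.* ∣ U ∣) (ℕP.*-monoʳ-≤ (z ℕ.^ r ℕ.* ∣ Π ∣) (ℤP.∣i-j∣≤∣i∣+∣j∣ G Pₖ)) ⟩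
      z ℕ.^ r ℕ.* ∣ Π ∣ ℕ.* (∣ G ∣ ℕ.+ ∣ Pₖ ∣) ℕ.+ q ℕ.* ∣ U ∣ ∎
      where
      open ℕP.≤-Reasoning
      ∣z^rΠ∣ : ∣ (+ z) ^ℤ r ℤ.* Π ∣ ≡ z ℕ.^ r ℕ.* ∣ Π ∣
      ∣z^rΠ∣ = trans (ℤP.abs-* ((+ z) ^ℤ r) Π) (cong (λ a → ∣ a ∣ ℕ.* ∣ Π ∣) (+-^ℤ z r))

    ∣E∣·w¹⁸≤ : ∣ E ∣ ℕ.* z ℕ.^ (36 ℕ.* 2 ℕ.^ n) ≤ 41 ℕ.* (z ℕ.^ N ℕ.* q)
    ∣E∣·w¹⁸≤ = begin
      ∣ E ∣ ℕ.* z ℕ.^ (36 ℕ.* 2 ℕ.^ n)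
        ≡⟨ cong (∣ E ∣ ℕ.*_) w¹⁸≡z^[36·2^n] ⟨
      ∣ E ∣ ℕ.* w ℕ.^ 18
        ≤⟨ ℕP.*-monoˡ-≤ (w ℕ.^ 18) (error-estimate {∣ E ∣} {z ℕ.^ r} {∣ Π ∣} {∣ G ∣} {∣ Pₖ ∣} {q} {∣ U ∣} {w ℕ.^ t} {ω} {w} {w ℕ.^ 9}
             1≤ω w≤2ω (ℕP.m^n>0 w {{w≢0}} t) ω∣G∣≤ ω∣Pₖ∣≤ ∣Π∣≤w ∣U∣≤z^r w⁹≤q ∣E∣≤) ⟩
      41 ℕ.* (z ℕ.^ r ℕ.* q ℕ.* w ℕ.^ t) ℕ.* w ℕ.^ 18
        ≡⟨ regroup (z ℕ.^ r) q (w ℕ.^ t) (w ℕ.^ 18) ⟩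
      41 ℕ.* (z ℕ.^ r ℕ.* (w ℕ.^ t ℕ.* w ℕ.^ 18) ℕ.* q)
        ≡⟨ cong (λ Z → 41 ℕ.* (Z ℕ.* q)) z^N≡ ⟨
      41 ℕ.* (z ℕ.^ N ℕ.* q) ∎
      where
      open ℕP.≤-Reasoning
      w≢0 : ℕ.NonZero w
      w≢0 = ℕ.>-nonZero (ℕP.≤-trans (s≤s z≤n) 2≤w)
      regroup : ∀ X q a b → 41 ℕ.* (X ℕ.* q ℕ.* a) ℕ.* b ≡ 41 ℕ.* (X ℕ.* (a ℕ.* b) ℕ.* q)
      regroup = ℕ-Solver.solve-∀
      z^N≡ : z ℕ.^ N ≡ z ℕ.^ r ℕ.* (w ℕ.^ t ℕ.* w ℕ.^ 18)
      z^N≡ = begin-equality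
        z ℕ.^ (K ℕ.* M ℕ.+ r)           ≡⟨ ℕP.^-distribˡ-+-* z (K ℕ.* M) r ⟩
        z ℕ.^ (K ℕ.* M) ℕ.* z ℕ.^ r     ≡⟨ ℕP.*-comm (z ℕ.^ (K ℕ.* M)) (z ℕ.^ r) ⟩
        z ℕ.^ r ℕ.* z ℕ.^ (K ℕ.* M)     ≡⟨ cong (λ e → z ℕ.^ r ℕ.* z ℕ.^ e) (ℕP.*-comm K M) ⟩
        z ℕ.^ r ℕ.* z ℕ.^ (M ℕ.* K)     ≡⟨ cong (z ℕ.^ r ℕ.*_) (ℕP.^-*-assoc z M K) ⟨
        z ℕ.^ r ℕ.* w ℕ.^ K             ≡⟨ cong (z ℕ.^ r ℕ.*_) (ℕP.^-distribˡ-+-* w t 18) ⟩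
        z ℕ.^ r ℕ.* (w ℕ.^ t ℕ.* w ℕ.^ 18) ∎

    partial-sum-bound : ℚ.∣ S (+ z) N ℚ.- frac (Ptilde n (+ z)) (Qtilde n (+ z)) ∣
                          ℚ.≤ C₄₁ ℚ.* frac (+ 1) ((+ z) ^ℤ (36 ℕ.* 2 ℕ.^ n))
    partial-sum-bound =
      subst₂ (λ ρ ε → ℚ.∣ S (+ z) N ℚ.- ρ ∣ ℚ.≤ C₄₁ ℚ.* ε)
        (sym (trans (cong (frac (Ptilde n (+ z))) Qtilde≡q) (frac-+ (Ptilde n (+ z)) q)))
        (sym (trans (cong (frac (+ 1)) (+-^ℤ z D)) (frac-+ (+ 1) (z ℕ.^ D) {{z^D≢0}})))
        (∣-∣≤-cross (S (+ z) N) (horner sgn (+ z) N) (Ptilde n (+ z)) 41 (z ℕ.^ N) q (z ℕ.^ D)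
          {{ℕP.m^n≢0 z N}} {{q≢0}} {{z^D≢0}} (S≃horner/z^N z N) ∣E∣·w¹⁸≤)
      where
      D : ℕ
      D = 36 ℕ.* 2 ℕ.^ n
      z^D≢0 : ℕ.NonZero (z ℕ.^ D)
      z^D≢0 = ℕP.m^n≢0 z D

  approximation : ∣f (+ z) - frac (Ptilde n (+ z)) (Qtilde n (+ z)) ∣≤ (C₄₁ ℚ.* frac (+ 1) ((+ z) ^ℤ (36 ℕ.* 2 ℕ.^ n)))
  approximation δ 0<δ = 18 ℕ.* M , λ N 18M≤N → ℚP.≤-trans (bound N (divMod-≥ 18 M N 18M≤N)) ε≤ε+δ
    where
    ε : ℚ
    ε = C₄₁ ℚ.* frac (+ 1) ((+ z) ^ℤ (36 ℕ.* 2 ℕ.^ n))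
    ε≤ε+δ : ε ℚ.≤ ε ℚ.+ δ
    ε≤ε+δ = ℚP.≤-trans (ℚP.≤-reflexive (sym (ℚP.+-identityʳ ε))) (ℚP.+-monoʳ-≤ ε (ℚP.<⇒≤ 0<δ))
    bound : ∀ N → ∃[ t ] ∃[ r ] (r < M × N ≡ (t ℕ.+ 18) ℕ.* M ℕ.+ r) →
            ℚ.∣ S (+ z) N ℚ.- frac (Ptilde n (+ z)) (Qtilde n (+ z)) ∣ ℚ.≤ ε
    bound N (t , r , r<M , N≡) = subst (λ N → ℚ.∣ S (+ z) N ℚ.- frac (Ptilde n (+ z)) (Qtilde n (+ z)) ∣ ℚ.≤ ε)
                                       (sym N≡) (PartialSum.partial-sum-bound t r r<M)

lemma2 : ∀ (z₀ : ℕ) → 2 ℕ.≤ z₀ →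
    ∃[ C ] (0ℚ ℚ.< C ×
      (∀ (n : ℕ) →
        (∣f (+ z₀) - frac (Ptilde n (+ z₀)) (Qtilde n (+ z₀)) ∣≤
           (C ℚ.* frac (+ 1) ((+ z₀) ^ℤ (36 ℕ.* 2 ℕ.^ n))))
        × Qtilde n (+ z₀) ℤ.≤ (+ 2) ℤ.* ((+ z₀) ^ℤ (18 ℕ.* 2 ℕ.^ n))))
lemma2 z₀ 2≤z₀ = C₄₁ , ℚ.*<* (ℤ.+<+ (s≤s z≤n)) , λ n →
  Approximation.approximation z₀ 2≤z₀ n , Approximation.Qtilde-bound z₀ 2≤z₀ n
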